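{- Let $m\ge 3$ and let $\mathcal{T}_1,\dots,\mathcal{T}_m$ be nonempty finite sets (layers) with sizes $t_i=|\mathcal{T}_i|$ such that $t_1\le t_j$ for all $j$. Consider elimination procedures of the following kind: start with the sequence of layers $(\mathcal{T}_1,\dots,\mathcal{T}_m)$ and perform $m-2$ steps; in each step remove one layer that is neither the first nor the last in the current sequence, at cost $|P|\cdot|R|\cdot|N|$, where $R$ is the removed layer and $P,N$ are its current predecessor and successor. For such a procedure $X$ let $$t(X)=2\Big[t_1t_m+\sum(\text{costs of the } m-2 \text{ steps})\Big].$$ Let $X_{\mathrm{seq}}$ be the procedure that always removes the second layer of the current sequence, so that $$t(X_{\mathrm{seq}})=2\Big[t_1t_m+\sum_{i=2}^{m-1}t_1t_it_{i+1}\Big].$$ Then $t(X_{\mathrm{seq}})\le 2\,t(X)$ for every such procedure $X$, and the factor $2$ is sharp: for every $\varepsilon>0$ there exist $m$ and layer sizes with $t_1=\min_j t_j$ such that $t(X_{\mathrm{seq}})>(2-\varepsilon)\min_X t(X)$.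
   Context: This models the number of weight evaluations in dynamic-programming computations of all shortest paths from the first to the last layer of a layered network with layers $\mathcal{T}_1,\dots,\mathcal{T}_m$ (edges only between consecutive layers): removing a layer $R$ between $P$ and $N$ means computing shortest paths from every vertex of $P$ to every vertex of $N$ through $R$, and $X_{\mathrm{seq}}$ is the sequential computation. The theorem is phrased in the paper as: if the first layer is the smallest, the sequential calculation is up to 2 times slower than the optimal dynamic programming algorithm, and this bound is sharp. -}

module Defs where

open import Data.Nat using (ℕ; zero; suc; _+_; _*_)
open import Data.Fin using (Fin; zero; suc)
open import Data.Vec using (Vec; []; _∷_; head; last)
open import Data.Product using (_×_; _,_; proj₁; proj₂)

-- Removing the interior layer at position (suc i) (i : Fin (suc n)),
-- i.e. one that is neither first nor last, from a sequence of (3 + n) layers: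
-- returns the cost |P|·|R|·|N| and the resulting sequence of (2 + n) layers.
removeInterior : ∀ {n} → Vec ℕ (3 + n) → Fin (suc n) → ℕ × Vec ℕ (2 + n)
removeInterior (p ∷ r ∷ q ∷ v) zero = p * r * q , p ∷ q ∷ v
removeInterior {suc n} (p ∷ v) (suc i) with removeInterior {n} v i
... | c , w = c , p ∷ w

removeCost : ∀ {n} → Vec ℕ (3 + n) → Fin (suc n) → ℕ
removeCost v i = proj₁ (removeInterior v i)

removeLayer : ∀ {n} → Vec ℕ (3 + n) → Fin (suc n) → Vec ℕ (2 + n)
removeLayer v i = proj₂ (removeInterior v i)

data Procedure : (n : ℕ) → Vec ℕ (2 + n) → Set where
  done : ∀ {v} → Procedure zero v
  step : ∀ {n} {v : Vec ℕ (3 + n)} (i : Fin (suc n)) →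
         Procedure n (removeLayer v i) → Procedure (suc n) v

stepsCost : ∀ {n v} → Procedure n v → ℕ
stepsCost done = 0
stepsCost {v = v} (step i X) = removeCost v i + stepsCost X

tCost : ∀ {n} (v : Vec ℕ (2 + n)) → Procedure n v → ℕ
tCost v X = 2 * (head v * last v + stepsCost X)

Xseq : ∀ n (v : Vec ℕ (2 + n)) → Procedure n v
Xseq zero v = done
Xseq (suc n) v = step zero (Xseq n (removeLayer v zero))

module Submission where

-- Write Q(v) = Σ v_j v_{j+1} for the sum of products of adjacent
-- layer sizes and P(v) = Q(tail v) for the same sum with the first layer dropped.
-- The sequential procedure costs exactly t₁ · P(t), since its i-th step
-- costs t₁ t_i t_{i+1}.  If every layer has size at least c, removing an
-- interior layer r between p and q changes Q by p q − p r − r q, and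
-- c (p r + r q) ≤ 2 p r q; hence c · Q (and likewise c · P) drops by at most
-- twice the cost of the step.  Summing over the steps of any procedure X,
-- whose final sequence has P = 0, gives c · P(t) ≤ 2 · (step costs of X).
-- With c = t₁ this is the bound t(X_seq) ≤ 2 t(X).
-- Sharpness is witnessed by the layer sizes 1, 1, N, 1: removing the big layer
-- first costs 2 (N + 2), while X_seq costs 2 (2 N + 1); for N = 3k the ratio
-- exceeds 2 − 1/k.

open import Defs
open import Data.Nat using (ℕ; zero; suc; _+_; _*_; _∸_; _≤_; _<_; z≤n; s≤s)
open import Data.Nat.Properties
open import Data.Fin using (Fin; zero; suc)
open import Data.Vec using (Vec; []; _∷_; head; lookup; last)
open import Data.Vec.Relation.Unary.All using (All; _∷_)
open import Data.Vec.Relation.Unary.All.Properties using (lookup⁻)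
open import Data.Product using (_×_; Σ; ∃; _,_; proj₁; proj₂)
open import Relation.Binary.PropositionalEquality
open import Data.Nat.Tactic.RingSolver using (solve-∀)

Q : ∀ {n} → Vec ℕ n → ℕ
Q [] = 0
Q (x ∷ []) = 0
Q (x ∷ y ∷ v) = x * y + Q (y ∷ v)

P : ∀ {n} → Vec ℕ n → ℕ
P [] = 0
P (x ∷ v) = Q v

removeInterior-suc : ∀ {n} p (v : Vec ℕ (3 + n)) (i : Fin (suc n)) →
  removeInterior (p ∷ v) (suc i) ≡ (removeCost v i , p ∷ removeLayer v i)
removeInterior-suc p (r ∷ q ∷ s ∷ v) i with removeInterior (r ∷ q ∷ s ∷ v) i
... | c , w = refl

removeLayer-suc : ∀ {n} p (v : Vec ℕ (3 + n)) (i : Fin (suc n)) →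
  removeLayer (p ∷ v) (suc i) ≡ p ∷ removeLayer v i
removeLayer-suc p v i = cong proj₂ (removeInterior-suc p v i)

removeCost-suc : ∀ {n} p (v : Vec ℕ (3 + n)) (i : Fin (suc n)) →
  removeCost (p ∷ v) (suc i) ≡ removeCost v i
removeCost-suc p v i = cong proj₁ (removeInterior-suc p v i)

head-removeLayer : ∀ {n} (v : Vec ℕ (3 + n)) (i : Fin (suc n)) →
  head (removeLayer v i) ≡ head v
head-removeLayer (p ∷ r ∷ q ∷ v) zero = refl
head-removeLayer {suc n} (p ∷ v) (suc i) = cong head (removeLayer-suc p v i)

All-removeLayer : ∀ {c n} (v : Vec ℕ (3 + n)) (i : Fin (suc n)) →
  All (c ≤_) v → All (c ≤_) (removeLayer v i)
All-removeLayer (p ∷ r ∷ q ∷ v) zero (c≤p ∷ _ ∷ rest) = c≤p ∷ rest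
All-removeLayer {c} {suc n} (p ∷ v) (suc i) (c≤p ∷ rest) =
  subst (All (c ≤_)) (sym (removeLayer-suc p v i)) (c≤p ∷ All-removeLayer v i rest)

Q-cons : ∀ {n} (x : ℕ) (w : Vec ℕ (suc n)) → Q (x ∷ w) ≡ x * head w + Q w
Q-cons x (y ∷ w) = refl

c*rq≤prq : ∀ c p r q → c ≤ p → c * (r * q) ≤ p * r * q
c*rq≤prq c p r q c≤p =
  subst (c * (r * q) ≤_) (sym (*-assoc p r q)) (*-monoˡ-≤ (r * q) c≤p)

c*pr≤prq : ∀ c p r q → c ≤ q → c * (p * r) ≤ p * r * q
c*pr≤prq c p r q c≤q =
  subst (c * (p * r) ≤_) (*-comm q (p * r)) (*-monoˡ-≤ (p * r) c≤q)

-- Key estimate: removing the interior layer r between p and q lowers c · Q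
-- by at most 2 p r q, because c (p r + r q) ≤ 2 p r q when c ≤ p, q.
Q-removeLayer : ∀ {c n} (v : Vec ℕ (3 + n)) (i : Fin (suc n)) → All (c ≤_) v →
  c * Q v ≤ 2 * removeCost v i + c * Q (removeLayer v i)
Q-removeLayer {c} (p ∷ r ∷ q ∷ v) zero (c≤p ∷ _ ∷ c≤q ∷ _) =
  begin
    c * (p * r + (r * q + Q (q ∷ v)))
  ≡⟨ expand c p r q (Q (q ∷ v)) ⟩
    c * (p * r) + c * (r * q) + c * Q (q ∷ v)
  ≤⟨ +-monoˡ-≤ (c * Q (q ∷ v)) (+-mono-≤ (c*pr≤prq c p r q c≤q) (c*rq≤prq c p r q c≤p)) ⟩
    p * r * q + p * r * q + c * Q (q ∷ v)
  ≤⟨ +-mono-≤ (≤-reflexive (double (p * r * q))) (m≤n+m (c * Q (q ∷ v)) (c * (p * q))) ⟩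
    2 * (p * r * q) + (c * (p * q) + c * Q (q ∷ v))
  ≡⟨ cong (2 * (p * r * q) +_) (sym (*-distribˡ-+ c (p * q) (Q (q ∷ v)))) ⟩
    2 * (p * r * q) + c * (p * q + Q (q ∷ v))
  ∎
  where
    open ≤-Reasoning
    expand : ∀ c p r q z → c * (p * r + (r * q + z)) ≡ c * (p * r) + c * (r * q) + c * z
    expand = solve-∀
    double : ∀ x → x + x ≡ 2 * x
    double = solve-∀
Q-removeLayer {c} {suc n} (p ∷ v) (suc i) (_ ∷ bound) =
  begin
    c * Q (p ∷ v)
  ≡⟨ cong (c *_) (Q-cons p v) ⟩
    c * (p * head v + Q v)
  ≡⟨ *-distribˡ-+ c (p * head v) (Q v) ⟩
    c * (p * head v) + c * Q v
  ≤⟨ +-monoʳ-≤ (c * (p * head v)) (Q-removeLayer v i bound) ⟩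
    c * (p * head v) + (2 * removeCost v i + c * Q v′)
  ≡⟨ regroup c (p * head v) (removeCost v i) (Q v′) ⟩
    2 * removeCost v i + c * (p * head v + Q v′)
  ≡⟨ cong (λ h → 2 * removeCost v i + c * (p * h + Q v′)) (sym (head-removeLayer v i)) ⟩
    2 * removeCost v i + c * (p * head v′ + Q v′)
  ≡⟨ cong (λ z → 2 * removeCost v i + c * z) (sym (Q-cons p v′)) ⟩
    2 * removeCost v i + c * Q (p ∷ v′)
  ≡⟨ sym (cong₂ (λ a b → 2 * a + c * Q b) (removeCost-suc p v i) (removeLayer-suc p v i)) ⟩
    2 * removeCost (p ∷ v) (suc i) + c * Q (removeLayer (p ∷ v) (suc i))
  ∎
  where
    open ≤-Reasoning
    v′ = removeLayer v i
    regroup : ∀ c x y z → c * x + (2 * y + c * z) ≡ 2 * y + c * (x + z)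
    regroup = solve-∀

-- The same estimate for P: removing the layer next to the first one drops the
-- product r q from P, and c r q ≤ p r q; any other removal is Q-removeLayer.
P-removeLayer : ∀ {c n} (v : Vec ℕ (3 + n)) (i : Fin (suc n)) → All (c ≤_) v →
  c * P v ≤ 2 * removeCost v i + c * P (removeLayer v i)
P-removeLayer {c} (p ∷ r ∷ q ∷ v) zero (c≤p ∷ _) =
  begin
    c * (r * q + Q (q ∷ v))
  ≡⟨ *-distribˡ-+ c (r * q) (Q (q ∷ v)) ⟩
    c * (r * q) + c * Q (q ∷ v)
  ≤⟨ +-monoˡ-≤ (c * Q (q ∷ v)) (≤-trans (c*rq≤prq c p r q c≤p) (m≤m+n _ _)) ⟩
    2 * (p * r * q) + c * Q (q ∷ v)
  ∎
  where open ≤-Reasoning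
P-removeLayer {c} {suc n} (p ∷ v) (suc i) (_ ∷ bound) =
  subst₂ (λ a w → c * Q v ≤ 2 * a + c * P w)
    (sym (removeCost-suc p v i)) (sym (removeLayer-suc p v i))
    (Q-removeLayer v i bound)

P-bound : ∀ {c n} (v : Vec ℕ (2 + n)) (X : Procedure n v) → All (c ≤_) v →
  c * P v ≤ 2 * stepsCost X
P-bound {c} (p ∷ q ∷ []) done _ = ≤-reflexive (*-zeroʳ c)
P-bound {c} v (step i X) bound =
  begin
    c * P v
  ≤⟨ P-removeLayer v i bound ⟩
    2 * removeCost v i + c * P (removeLayer v i)
  ≤⟨ +-monoʳ-≤ (2 * removeCost v i) (P-bound (removeLayer v i) X (All-removeLayer v i bound)) ⟩
    2 * removeCost v i + 2 * stepsCost X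
  ≡⟨ sym (*-distribˡ-+ 2 (removeCost v i) (stepsCost X)) ⟩
    2 * (removeCost v i + stepsCost X)
  ∎
  where open ≤-Reasoning

Xseq-stepsCost : ∀ n (v : Vec ℕ (2 + n)) → stepsCost (Xseq n v) ≡ head v * P v
Xseq-stepsCost zero (p ∷ q ∷ []) = sym (*-zeroʳ p)
Xseq-stepsCost (suc n) (p ∷ r ∷ q ∷ v) =
  trans (cong (p * r * q +_) (Xseq-stepsCost n (p ∷ q ∷ v))) (factor p r q (Q (q ∷ v)))
  where
    factor : ∀ p r q z → p * r * q + p * z ≡ p * (r * q + z)
    factor = solve-∀

Xseq-at-most-twice : ∀ n (t : Vec ℕ (2 + n)) → All (head t ≤_) t →
  (X : Procedure n t) → tCost t (Xseq n t) ≤ 2 * tCost t X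
Xseq-at-most-twice n t bound X =
  begin
    2 * (h * l + stepsCost (Xseq n t))
  ≡⟨ cong (λ z → 2 * (h * l + z)) (Xseq-stepsCost n t) ⟩
    2 * (h * l + h * P t)
  ≤⟨ *-monoʳ-≤ 2 (+-mono-≤ (m≤m+n (h * l) (h * l)) (P-bound t X bound)) ⟩
    2 * (h * l + h * l + 2 * stepsCost X)
  ≡⟨ regroup (h * l) (stepsCost X) ⟩
    2 * (2 * (h * l + stepsCost X))
  ∎
  where
    open ≤-Reasoning
    h = head t
    l = last t
    regroup : ∀ a s → 2 * (a + a + 2 * s) ≡ 2 * (2 * (a + s))
    regroup = solve-∀

sharpLayers : ℕ → Vec ℕ 4
sharpLayers N = 1 ∷ 1 ∷ N ∷ 1 ∷ []

-- Removing the big layer first, while both its neighbours have size 1.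
bigFirst : ∀ N → Procedure 2 (sharpLayers N)
bigFirst N = step (suc zero) (step zero done)

bigFirst-tCost : ∀ N → tCost (sharpLayers N) (bigFirst N) ≡ 2 * (N + 2)
bigFirst-tCost N = arithmetic N
  where
    arithmetic : ∀ N → 2 * (1 * 1 + (1 * N * 1 + (1 * 1 * 1 + 0))) ≡ 2 * (N + 2)
    arithmetic = solve-∀

Xseq-tCost : ∀ N → tCost (sharpLayers N) (Xseq 2 (sharpLayers N)) ≡ 2 * (2 * N + 1)
Xseq-tCost N = arithmetic N
  where
    arithmetic : ∀ N → 2 * (1 * 1 + (1 * 1 * N + (1 * N * 1 + 0))) ≡ 2 * (2 * N + 1)
    arithmetic = solve-∀

sharp-ratio : ∀ k → 1 ≤ k → (2 * k ∸ 1) * (2 * (3 * k + 2)) < k * (2 * (2 * (3 * k) + 1))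
sharp-ratio (suc j) _ =
  subst (λ x → x * (2 * (3 * suc j + 2)) < suc j * (2 * (2 * (3 * suc j) + 1)))
    (sym (+-suc j (j + 0)))
    (subst ((1 + 2 * j) * (2 * (3 * suc j + 2)) <_) (identity j) (m<m+n _ (s≤s z≤n)))
  where
    identity : ∀ j → (1 + 2 * j) * (2 * (3 * suc j + 2)) + 4 ≡ suc j * (2 * (2 * (3 * suc j) + 1))
    identity = solve-∀

sharpLayers-positive : ∀ N → 1 ≤ N → (j : Fin 4) → 1 ≤ lookup (sharpLayers N) j
sharpLayers-positive N _ zero = s≤s z≤n
sharpLayers-positive N _ (suc zero) = s≤s z≤n
sharpLayers-positive N 1≤N (suc (suc zero)) = 1≤N
sharpLayers-positive N _ (suc (suc (suc zero))) = s≤s z≤n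

Xseq-nearly-twice : ∀ k → 1 ≤ k →
  (2 * k ∸ 1) * tCost (sharpLayers (3 * k)) (bigFirst (3 * k))
    < k * tCost (sharpLayers (3 * k)) (Xseq 2 (sharpLayers (3 * k)))
Xseq-nearly-twice k 1≤k =
  subst₂ (λ a b → (2 * k ∸ 1) * a < k * b)
    (sym (bigFirst-tCost (3 * k))) (sym (Xseq-tCost (3 * k))) (sharp-ratio k 1≤k)

theorem2 :
    ((n : ℕ) → 1 ≤ n → (t : Vec ℕ (2 + n)) →
      ((j : Fin (2 + n)) → 1 ≤ lookup t j) →
      ((j : Fin (2 + n)) → head t ≤ lookup t j) →
      (X : Procedure n t) → tCost t (Xseq n t) ≤ 2 * tCost t X)
    ×
    ((k : ℕ) → 1 ≤ k →
      Σ ℕ λ n → 1 ≤ n × Σ (Vec ℕ (2 + n)) λ t →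
        ((j : Fin (2 + n)) → 1 ≤ lookup t j) ×
        ((j : Fin (2 + n)) → head t ≤ lookup t j) ×
        ∃ λ (X : Procedure n t) → (2 * k ∸ 1) * tCost t X < k * tCost t (Xseq n t))
theorem2 =
    (λ n _ t _ head-min X → Xseq-at-most-twice n t (lookup⁻ head-min) X)
  , λ k 1≤k →
      let positive : (j : Fin 4) → 1 ≤ lookup (sharpLayers (3 * k)) j
          positive = sharpLayers-positive (3 * k) (≤-trans 1≤k (m≤n*m k 3))
      in 2 , s≤s z≤n , sharpLayers (3 * k) , positive , positive ,
         bigFirst (3 * k) , Xseq-nearly-twice k 1≤k
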